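{- Let $G$ be a graph, $h$ a positive integer, and $X\subseteq V(G)$ a set such that $G-X$ is a disjoint union of cliques. Let $F\subseteq E(G)$ be an optimal solution, i.e. a minimum-size edge set such that every connected component of $G\setminus F$ has at most $h$ vertices. Let $C$ be a connected component of $G-X$ and let $C'\subseteq V(C)$ be the set of vertices of $C$ that belong to connected components of $G\setminus F$ which do not intersect $X$. If $|C'|=qh+r$ with $q,r\in\mathbb{N}$ and $0\le r<h$, then in $G\setminus F$ the set $C'$ induces a disjoint union of $q$ cliques of size $h$ and one clique of size $r$.
   Context: Graphs are finite, simple, undirected; $G\setminus F$ denotes the graph obtained from $G$ by deleting the edges in $F$. -}

module Defs where

open import Data.Nat using (ℕ; zero; suc; _+_; _*_; _≤_; _<_)
open import Data.Fin using (Fin; toℕ)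
open import Data.Bool using (Bool; true; false; _∧_; not; if_then_else_)
open import Data.List using (List; length; map; allFin)
open import Data.Nat.ListAction using (sum)
open import Data.Empty using (⊥)
open import Data.List.Relation.Unary.All using (All)
open import Data.List.Relation.Unary.Unique.Propositional using (Unique)
open import Data.List.Membership.Propositional using (_∈_)
open import Data.Product using (Σ; _×_)
open import Data.Unit using (⊤)
open import Relation.Binary.PropositionalEquality using (_≡_)
open import Relation.Nullary.Decidable using (⌊_⌋)
import Data.Nat as ℕ

record Graph (n : ℕ) : Set where
  field
    adj    : Fin n → Fin n → Bool
    sym    : ∀ u v → adj u v ≡ adj v u
    irrefl : ∀ v → adj v v ≡ false
open Graph public

record EdgeSet {n : ℕ} (G : Graph n) : Set where
  field
    mem    : Fin n → Fin n → Bool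
    memSym : ∀ u v → mem u v ≡ mem v u
    memSub : ∀ u v → mem u v ≡ true → adj G u v ≡ true
open EdgeSet public

-- |F| : number of unordered pairs {u,v} (counted once, u < v) in F.
edgeCount : {n : ℕ} {G : Graph n} → EdgeSet G → ℕ
edgeCount {n} F =
  sum (map (λ u → sum (map (λ v →
        if (⌊ toℕ u ℕ.<? toℕ v ⌋ ∧ mem F u v) then 1 else 0) (allFin n))) (allFin n))

delAdj : {n : ℕ} {G : Graph n} → EdgeSet G → Fin n → Fin n → Bool
delAdj {G = G} F u v = adj G u v ∧ not (mem F u v)

data Reach {n : ℕ} (A : Fin n → Fin n → Bool) (S : Fin n → Set) :
           Fin n → Fin n → Set where
  here : ∀ {u} → S u → Reach A S u u
  step : ∀ {u w v} → S u → A u w ≡ true → Reach A S w v → Reach A S u v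

AllV : {n : ℕ} → Fin n → Set
AllV _ = ⊤

HasSize : {n : ℕ} → (Fin n → Set) → ℕ → Set
HasSize {n} S k =
  Σ (List (Fin n)) λ xs → Unique xs × length xs ≡ k × (∀ v → (v ∈ xs → S v) × (S v → v ∈ xs))

-- Every connected component of G \ F has at most h vertices:
-- no h+1 distinct vertices lie in a common component.
ValidSol : {n : ℕ} {G : Graph n} → ℕ → EdgeSet G → Set
ValidSol {n} h F = ∀ (v : Fin n) (xs : List (Fin n)) → Unique xs →
  All (Reach (delAdj F) AllV v) xs → length xs ≤ h

Optimal : {n : ℕ} {G : Graph n} → ℕ → EdgeSet G → Set
Optimal {G = G} h F = ValidSol h F × (∀ (F' : EdgeSet G) → ValidSol h F' → edgeCount F ≤ edgeCount F')

Out : {n : ℕ} → (Fin n → Bool) → Fin n → Set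
Out X v = X v ≡ false

-- G - X is a disjoint union of cliques: every component of G - X is a clique.
CliquesAfterRemoving : {n : ℕ} → Graph n → (Fin n → Bool) → Set
CliquesAfterRemoving G X = ∀ u v → Reach (adj G) (Out X) u v → (u ≡ v → ⊥) → adj G u v ≡ true

-- V(C) for the component C of G - X containing the vertex c (c ∉ X).
InComp : {n : ℕ} → Graph n → (Fin n → Bool) → Fin n → Fin n → Set
InComp G X c v = Reach (adj G) (Out X) c v

CPrime : {n : ℕ} {G : Graph n} → (Fin n → Bool) → EdgeSet G → Fin n → Fin n → Set
CPrime {G = G} X F c v = InComp G X c v × (∀ x → Reach (delAdj F) AllV v x → X x ≡ false)

{-# OPTIONS --safe #-}
-- An optimal F contains no edge inside a component of G ∖ F: restoring it merges
-- nothing and is cheaper. C′ is a union of components of G ∖ F whose vertices are pairwise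
-- adjacent in G (they lie in the clique C), so these components are cliques of G ∖ F.
-- If two of them, K ∋ a and K′ ∋ b with |K′| ≤ |K|, had fewer than h vertices, b could be
-- moved into K, restoring its |K| edges to K and cutting its |K′| - 1 edges inside K′: a
-- cheaper solution. So all components in C′ but one have exactly h vertices, and
-- |C′| = qh + r leaves q of them and one of size r.

module Submission where

open import Defs hiding (sym)
open import Data.Nat using (ℕ; zero; suc; _+_; _*_; _≤_; _<_; z≤n; s≤s; _<?_; _≤?_)
open import Data.Nat.Properties
  using (+-0-commutativeMonoid; module ≤-Reasoning; ≤-refl; ≤-trans; ≤-antisym; ≤-total; <-asym; <-≤-trans;
         <⇒≱; ≰⇒>; ≮⇒≥; m≤m+n; +-assoc; +-identityʳ; +-cancelˡ-≡; +-cancelʳ-<; +-mono-≤; +-mono-<; +-monoʳ-<)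
open import Data.Fin using (Fin; zero; suc; toℕ; inject₁; fromℕ)
open import Data.Fin.Properties using (_≟_; toℕ-injective; suc-injective) renaming (any? to anyFin?)
open import Data.Bool using (Bool; true; false; _∧_; _∨_; not; if_then_else_)
open import Data.Bool.Properties using (∧-identityʳ; ∧-zeroʳ; ∨-comm; ∨-zeroʳ; T-≡; not-¬; ¬-not; ⇔→≡) renaming (_≟_ to _≟ᵇ_)
open import Data.List using (List; []; _∷_; length; map; allFin; tabulate; filter)
open import Data.List.Properties using (map-tabulate; map-cong)
import Data.Nat.ListAction as List
open import Data.List.Relation.Unary.All using (All)
import Data.List.Relation.Unary.All as All
open import Data.List.Relation.Unary.AllPairs using (_∷_)
open import Data.List.Relation.Unary.Unique.Propositional using (Unique)
open import Data.List.Relation.Unary.Unique.Propositional.Properties using (allFin⁺; filter⁺)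
open import Data.List.Relation.Unary.Any using (any?)
open import Data.List.Membership.Propositional using (_∈_)
open import Data.List.Membership.Propositional.Properties using (∈-filter⁺; ∈-filter⁻; ∈-allFin)
open import Data.Unit using (tt)
open import Data.Product using (Σ; ∃; _×_; _,_; proj₁; proj₂)
open import Data.Sum using (_⊎_; inj₁; inj₂)
open import Data.Empty using (⊥; ⊥-elim)
open import Function using (_∘_; id; Equivalence; mk⇔)
open import Relation.Binary.PropositionalEquality
open import Relation.Nullary using (yes; no; does; contradiction)
open import Relation.Nullary.Decidable using (Dec; T?; _×-dec_; dec-true; dec-false; ⌊_⌋)
open import Algebra.Properties.CommutativeMonoid.Sum +-0-commutativeMonoid
  using (sum; sum-syntax; ∑-distrib-+; ∑-comm; sum-cong-≗; sum-replicate-zero)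

private variable
  n : ℕ

dec-sound : ∀ {a} {A : Set a} (a? : Dec A) → does a? ≡ true → A
dec-sound (yes a) _ = a

∨-true⁻ : {a b : Bool} → a ∨ b ≡ true → a ≡ true ⊎ b ≡ true
∨-true⁻ {true}  _ = inj₁ refl
∨-true⁻ {false} e = inj₂ e

∧-true⁻ : {a b : Bool} → a ∧ b ≡ true → a ≡ true × b ≡ true
∧-true⁻ {true} e = refl , e

m+o≡n+p⇒p<o⇒m<n : {m n o p : ℕ} → m + o ≡ n + p → p < o → m < n
m+o≡n+p⇒p<o⇒m<n {m} {n} {o} {p} eq p<o = +-cancelʳ-< o m n (begin-strict
  m + o  ≡⟨ eq ⟩
  n + p  <⟨ +-monoʳ-< n p<o ⟩
  n + o  ∎)
  where open ≤-Reasoning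

ind : Bool → ℕ
ind b = if b then 1 else 0

_==_ : Fin n → Fin n → Bool
x == y = does (x ≟ y)

_∈ᵇ_ : Fin n → List (Fin n) → Bool
x ∈ᵇ xs = does (any? (x ≟_) xs)

count : (Fin n → Bool) → ℕ
count {n} p = ∑[ i < n ] ind (p i)

sum-+-cong : {f g f′ g′ : Fin n → ℕ} → (∀ i → f i + g i ≡ f′ i + g′ i) →
  sum f + sum g ≡ sum f′ + sum g′
sum-+-cong {f = f} {g} {f′} {g′} eq = begin
  sum f + sum g                  ≡⟨ ∑-distrib-+ f g ⟨
  ∑[ i < _ ] (f i + g i)         ≡⟨ sum-cong-≗ eq ⟩
  ∑[ i < _ ] (f′ i + g′ i)       ≡⟨ ∑-distrib-+ f′ g′ ⟩
  sum f′ + sum g′                ∎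
  where open ≡-Reasoning

count-cong : {p q : Fin n → Bool} → (∀ i → p i ≡ q i) → count p ≡ count q
count-cong eq = sum-cong-≗ (cong ind ∘ eq)

count-mono : {p q : Fin n → Bool} → (∀ i → p i ≡ true → q i ≡ true) → count p ≤ count q
count-mono {zero}  p⊆q = z≤n
count-mono {suc n} {p} {q} p⊆q = +-mono-≤ (ind-mono (p⊆q zero)) (count-mono (p⊆q ∘ suc))
  where
  ind-mono : ∀ {a b} → (a ≡ true → b ≡ true) → ind a ≤ ind b
  ind-mono {false} _ = z≤n
  ind-mono {true}  a⇒b rewrite a⇒b refl = ≤-refl

count-∨ : {p q : Fin n → Bool} → (∀ i → p i ≡ true → q i ≡ false) →
  count (λ i → p i ∨ q i) ≡ count p + count q
count-∨ {p = p} {q} disjoint =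
  trans (sum-cong-≗ (λ i → ind-∨ (disjoint i))) (∑-distrib-+ (ind ∘ p) (ind ∘ q))
  where
  ind-∨ : ∀ {a b} → (a ≡ true → b ≡ false) → ind (a ∨ b) ≡ ind a + ind b
  ind-∨ {false} _ = refl
  ind-∨ {true}  a⇒¬b rewrite a⇒¬b refl = refl

count-∖ : {p q : Fin n → Bool} → (∀ i → q i ≡ true → p i ≡ true) →
  count p ≡ count q + count (λ i → p i ∧ not (q i))
count-∖ {p = p} {q} q⊆p =
  trans (sum-cong-≗ (λ i → ind-∖ (q⊆p i))) (∑-distrib-+ (ind ∘ q) _)
  where
  ind-∖ : ∀ {a b} → (b ≡ true → a ≡ true) → ind a ≡ ind b + ind (a ∧ not b)
  ind-∖ {a} {false} _ rewrite ∧-identityʳ a = refl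
  ind-∖ {a} {true}  b⇒a rewrite b⇒a refl = refl

count-false : ∀ n → count {n} (λ _ → false) ≡ 0
count-false zero    = refl
count-false (suc n) = count-false n

count-δ : (b : Fin n) (f : Fin n → Bool) → count (λ i → (i == b) ∧ f i) ≡ ind (f b)
count-δ {suc n} zero    f = trans (cong (ind (f zero) +_) (count-false n)) (+-identityʳ _)
count-δ {suc n} (suc b) f = count-δ b (f ∘ suc)

count-singleton : (b : Fin n) → count (_== b) ≡ 1
count-singleton b = trans (count-cong (λ i → sym (∧-identityʳ (i == b)))) (count-δ b (λ _ → true))

count-witness : {p q : Fin n → Bool} → count p < count q → ∃ λ i → q i ≡ true × p i ≡ false
count-witness {p = p} {q} p<q with anyFin? (λ i → (q i ≟ᵇ true) ×-dec (p i ≟ᵇ false))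
... | yes witness = witness
... | no none = contradiction (count-mono q⊆p) (<⇒≱ p<q)
  where
  q⊆p : ∀ i → q i ≡ true → p i ≡ true
  q⊆p i qi with p i in pi
  ... | true  = refl
  ... | false = contradiction (i , qi , pi) none

∈ᵇ⇒∈ : {x : Fin n} (xs : List (Fin n)) → x ∈ᵇ xs ≡ true → x ∈ xs
∈ᵇ⇒∈ {x = x} xs = dec-sound (any? (x ≟_) xs)

∈⇒∈ᵇ : {x : Fin n} {xs : List (Fin n)} → x ∈ xs → x ∈ᵇ xs ≡ true
∈⇒∈ᵇ {x = x} {xs} = dec-true (any? (x ≟_) xs)

∈ᵇ-≗ : (xs : List (Fin n)) (p : Fin n → Bool) → (∀ v → v ∈ xs → p v ≡ true) →
  (∀ v → p v ≡ true → v ∈ xs) → ∀ v → v ∈ᵇ xs ≡ p v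
∈ᵇ-≗ xs p ∈⇒p p⇒∈ v with p v in pv
... | true  = ∈⇒∈ᵇ (p⇒∈ v pv)
... | false with v ∈ᵇ xs in v∈xs
...   | true  = trans (sym (∈⇒p v (∈ᵇ⇒∈ xs v∈xs))) pv
...   | false = refl

count-∈ᵇ : {xs : List (Fin n)} → Unique xs → count (_∈ᵇ xs) ≡ length xs
count-∈ᵇ {n} {xs = []} _ = count-false n
count-∈ᵇ {xs = x ∷ xs} (x∉xs ∷ xs!) = begin
  count (λ v → (v == x) ∨ (v ∈ᵇ xs))  ≡⟨ count-∨ disjoint ⟩
  count (_== x) + count (_∈ᵇ xs)      ≡⟨ cong₂ _+_ (count-singleton x) (count-∈ᵇ xs!) ⟩
  suc (length xs)                     ∎
  where
  open ≡-Reasoning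
  disjoint : ∀ v → v == x ≡ true → v ∈ᵇ xs ≡ false
  disjoint v v=x with v ∈ᵇ xs in v∈xs
  ... | false = refl
  ... | true  rewrite dec-sound (v ≟ x) v=x =
    contradiction refl (All.lookup x∉xs (∈ᵇ⇒∈ xs v∈xs))

unique-length≤count : (p : Fin n → Bool) {xs : List (Fin n)} → Unique xs →
  All (λ x → p x ≡ true) xs → length xs ≤ count p
unique-length≤count p {xs} xs! xs⊆p = begin
  length xs         ≡⟨ count-∈ᵇ xs! ⟨
  count (_∈ᵇ xs)    ≤⟨ count-mono {p = _∈ᵇ xs} (λ v → All.lookup xs⊆p ∘ ∈ᵇ⇒∈ xs) ⟩
  count p           ∎
  where open ≤-Reasoning

HasSize⇒count : {Q : Fin n → Set} {k : ℕ} (size : HasSize Q k) → count (_∈ᵇ proj₁ size) ≡ k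
HasSize⇒count (_ , xs! , |xs| , _) = trans (count-∈ᵇ xs!) |xs|

count⇒HasSize : (Q : Fin n → Set) (p : Fin n → Bool) → (∀ v → Q v → p v ≡ true) →
  (∀ v → p v ≡ true → Q v) → {k : ℕ} → count p ≡ k → HasSize Q k
count⇒HasSize {n} Q p Q⇒p p⇒Q |p| =
  ys , ys! , trans (sym (count-∈ᵇ ys!)) (trans (count-cong (∈ᵇ-≗ ys p ∈ys⇒p p⇒∈ys)) |p|) ,
  λ v → p⇒Q v ∘ ∈ys⇒p v , p⇒∈ys v ∘ Q⇒p v
  where
  ys : List (Fin n)
  ys = filter (T? ∘ p) (allFin n)
  ys! : Unique ys
  ys! = filter⁺ (T? ∘ p) (allFin⁺ n)
  ∈ys⇒p : ∀ v → v ∈ ys → p v ≡ true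
  ∈ys⇒p v = Equivalence.to T-≡ ∘ proj₂ ∘ ∈-filter⁻ (T? ∘ p) {xs = allFin n}
  p⇒∈ys : ∀ v → p v ≡ true → v ∈ ys
  p⇒∈ys v = ∈-filter⁺ (T? ∘ p) (∈-allFin v) ∘ Equivalence.from T-≡

fibre-size : {m : ℕ} (Q : Fin n → Set) (S : Fin n → Bool) → (∀ v → Q v → S v ≡ true) →
  (∀ v → S v ≡ true → Q v) → (label : Fin n → Fin m) (t : Fin m) {k : ℕ} →
  count (λ v → S v ∧ (label v == t)) ≡ k → HasSize (λ v → Q v × label v ≡ t) k
fibre-size Q S Q⇒S S⇒Q label t =
  count⇒HasSize _ (λ v → S v ∧ (label v == t)) in-fibre (λ v → out-of-fibre v)
  where
  in-fibre : ∀ v → Q v × label v ≡ t → S v ∧ (label v == t) ≡ true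
  in-fibre v (qv , refl) rewrite Q⇒S v qv = dec-true (label v ≟ label v) refl
  out-of-fibre : ∀ v → S v ∧ (label v == t) ≡ true → Q v × label v ≡ t
  out-of-fibre v e with S v in sv
  ... | true = S⇒Q v sv , dec-sound (label v ≟ t) e

_≺_ : Fin n → Fin n → Bool
u ≺ v = ⌊ toℕ u <? toℕ v ⌋

pairCount : (Fin n → Fin n → Bool) → ℕ
pairCount {n} m = ∑[ u < n ] count (λ v → (u ≺ v) ∧ m u v)

degreeSum : (Fin n → Fin n → Bool) → ℕ
degreeSum {n} m = ∑[ u < n ] count (m u)

sum-allFin : (f : Fin n → ℕ) → List.sum (map f (allFin n)) ≡ sum f
sum-allFin f = trans (cong List.sum (map-tabulate id f)) (sum-tabulate f)
  where
  sum-tabulate : ∀ {m} (g : Fin m → ℕ) → List.sum (tabulate g) ≡ sum g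
  sum-tabulate {zero}  g = refl
  sum-tabulate {suc m} g = cong (g zero +_) (sum-tabulate (g ∘ suc))

edgeCount≡pairCount : {G : Graph n} (F : EdgeSet G) → edgeCount F ≡ pairCount (mem F)
edgeCount≡pairCount {n} F =
  trans (cong List.sum (map-cong (λ u → sum-allFin (λ v → ind ((u ≺ v) ∧ mem F u v))) (allFin n)))
        (sum-allFin (λ u → count (λ v → (u ≺ v) ∧ mem F u v)))

ind-≺-split : (u v : Fin n) (s : Bool) → (u ≡ v → s ≡ false) →
  ind ((u ≺ v) ∧ s) + ind ((v ≺ u) ∧ s) ≡ ind s
ind-≺-split u v s u≡v⇒¬s with toℕ u <? toℕ v | toℕ v <? toℕ u
... | yes u<v | yes v<u = contradiction u<v (<-asym v<u)
... | yes _   | no _    = +-identityʳ (ind s)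
... | no _    | yes _   = refl
... | no u≮v  | no v≮u rewrite u≡v⇒¬s (toℕ-injective (≤-antisym (≮⇒≥ v≮u) (≮⇒≥ u≮v))) = refl

-- Solutions are compared through degree sums, which need no orientation of the edges.
handshake : {m : Fin n → Fin n → Bool} → (∀ u v → m u v ≡ m v u) → (∀ u → m u u ≡ false) →
  pairCount m + pairCount m ≡ degreeSum m
handshake {n} {m} m-sym m-irrefl = begin
  pairCount m + pairCount m
    ≡⟨ cong (pairCount m +_) (∑-comm (λ u v → ind ((u ≺ v) ∧ m u v))) ⟩
  pairCount m + ∑[ v < n ] count (λ u → (u ≺ v) ∧ m u v)
    ≡⟨ ∑-distrib-+ (λ u → count (λ v → (u ≺ v) ∧ m u v)) (λ u → count (λ v → (v ≺ u) ∧ m v u)) ⟨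
  ∑[ u < n ] (count (λ v → (u ≺ v) ∧ m u v) + count (λ v → (v ≺ u) ∧ m v u))
    ≡⟨ sum-cong-≗ (λ u → ∑-distrib-+ (λ v → ind ((u ≺ v) ∧ m u v)) (λ v → ind ((v ≺ u) ∧ m v u))) ⟨
  ∑[ u < n ] ∑[ v < n ] (ind ((u ≺ v) ∧ m u v) + ind ((v ≺ u) ∧ m v u))
    ≡⟨ sum-cong-≗ (λ u → sum-cong-≗ (λ v → split u v)) ⟩
  degreeSum m
    ∎
  where
  open ≡-Reasoning
  split : ∀ u v → ind ((u ≺ v) ∧ m u v) + ind ((v ≺ u) ∧ m v u) ≡ ind (m u v)
  split u v rewrite m-sym v u = ind-≺-split u v (m u v) (λ { refl → m-irrefl u })

degreeSum-∅ : ∀ n → degreeSum {n} (λ _ _ → false) ≡ 0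
degreeSum-∅ n = trans (sum-cong-≗ {n} (λ _ → count-false n)) (sum-replicate-zero n)

star : Fin n → (Fin n → Bool) → Fin n → Fin n → Bool
star b S x y = ((x == b) ∧ S y) ∨ ((y == b) ∧ S x)

star-sym : (b : Fin n) (S : Fin n → Bool) → ∀ x y → star b S x y ≡ star b S y x
star-sym b S x y = ∨-comm ((x == b) ∧ S y) ((y == b) ∧ S x)

star-centre : (b : Fin n) (S : Fin n → Bool) {y : Fin n} → S y ≡ true → star b S b y ≡ true
star-centre b S Sy rewrite dec-true (b ≟ b) refl | Sy = refl

star⁻ : (b : Fin n) (S : Fin n → Bool) {x y : Fin n} → star b S x y ≡ true →
  (x ≡ b × S y ≡ true) ⊎ (y ≡ b × S x ≡ true)
star⁻ b S {x} {y} e with ∨-true⁻ e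
... | inj₁ e₁ = inj₁ (dec-sound (x ≟ b) (proj₁ (∧-true⁻ e₁)) , proj₂ (∧-true⁻ e₁))
... | inj₂ e₂ = inj₂ (dec-sound (y ≟ b) (proj₁ (∧-true⁻ e₂)) , proj₂ (∧-true⁻ e₂))

degreeSum-star : (b : Fin n) (S : Fin n → Bool) → S b ≡ false →
  degreeSum (star b S) ≡ count S + count S
degreeSum-star {n} b S Sb = begin
  degreeSum (star b S)
    ≡⟨ sum-cong-≗ (λ u → count-∨ (disjoint u)) ⟩
  ∑[ u < n ] (count (λ v → (u == b) ∧ S v) + count (λ v → (v == b) ∧ S u))
    ≡⟨ ∑-distrib-+ (λ u → count (λ v → (u == b) ∧ S v)) (λ u → count (λ v → (v == b) ∧ S u)) ⟩
  ∑[ u < n ] count (λ v → (u == b) ∧ S v) + ∑[ u < n ] count (λ v → (v == b) ∧ S u)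
    ≡⟨ cong₂ _+_ (∑-comm (λ u v → ind ((u == b) ∧ S v))) (sum-cong-≗ (λ u → count-δ b (λ _ → S u))) ⟩
  ∑[ v < n ] count (λ u → (u == b) ∧ S v) + count S
    ≡⟨ cong (_+ count S) (sum-cong-≗ (λ v → count-δ b (λ _ → S v))) ⟩
  count S + count S
    ∎
  where
  open ≡-Reasoning
  disjoint : ∀ u v → (u == b) ∧ S v ≡ true → (v == b) ∧ S u ≡ false
  disjoint u v e with v ≟ b
  ... | no _     = refl
  ... | yes refl = ⊥-elim (not-¬ e (trans (cong ((u == b) ∧_) Sb) (∧-zeroʳ (u == b))))

module _ {A : Fin n → Fin n → Bool} {S : Fin n → Set} where

  reach-end : {u v : Fin n} → Reach A S u v → S v
  reach-end (here s)     = s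
  reach-end (step _ _ r) = reach-end r

  reach-trans : {u w v : Fin n} → Reach A S u w → Reach A S w v → Reach A S u v
  reach-trans (here _)      r = r
  reach-trans (step s a r₁) r = step s a (reach-trans r₁ r)

  reach-snoc : {u w v : Fin n} → Reach A S u w → A w v ≡ true → S v → Reach A S u v
  reach-snoc r a sv = reach-trans r (step (reach-end r) a (here sv))

  reach-sym : (∀ x y → A x y ≡ A y x) → {u v : Fin n} → Reach A S u v → Reach A S v u
  reach-sym A-sym (here s)               = here s
  reach-sym A-sym (step {u} {w} su a r) = reach-snoc (reach-sym A-sym r) (trans (A-sym w u) a) su

  reach-closed : {P : Fin n → Set} → (∀ x y → A x y ≡ true → P x → P y) →
    {u v : Fin n} → Reach A S u v → P u → P v
  reach-closed P-closed (here _)            pu = pu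
  reach-closed P-closed (step {u} {w} _ a r) pu = reach-closed P-closed r (P-closed u w a pu)

  reach-restrict : {B : Fin n → Fin n → Bool} {P : Fin n → Set} →
    (∀ x y → A x y ≡ true → P x → P y × B x y ≡ true) →
    {u v : Fin n} → Reach A S u v → P u → Reach B S u v
  reach-restrict P-step (here s)               pu = here s
  reach-restrict P-step (step {u} {w} s a r) pu =
    step s (proj₂ (P-step u w a pu)) (reach-restrict P-step r (proj₁ (P-step u w a pu)))

reach-map : {A B : Fin n → Fin n → Bool} {S : Fin n → Set} → (∀ x y → A x y ≡ true → Reach B S x y) →
  {u v : Fin n} → Reach A S u v → Reach B S u v
reach-map A⇒B (here s)             = here s
reach-map A⇒B (step {u} {w} _ a r) = reach-trans (A⇒B u w a) (reach-map A⇒B r)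

edge : {A : Fin n → Fin n → Bool} {u v : Fin n} → A u v ≡ true → Reach A AllV u v
edge a = step tt a (here tt)

module _ {G : Graph n} where

  delAdj-sym : (F : EdgeSet G) → ∀ x y → delAdj F x y ≡ delAdj F y x
  delAdj-sym F x y = cong₂ (λ a m → a ∧ not m) (Graph.sym G x y) (memSym F x y)

  delAdj⇒adj : (F : EdgeSet G) {x y : Fin n} → delAdj F x y ≡ true → adj G x y ≡ true
  delAdj⇒adj F = proj₁ ∘ ∧-true⁻

  delAdj⇒∉F : (F : EdgeSet G) {x y : Fin n} → delAdj F x y ≡ true → mem F x y ≡ false
  delAdj⇒∉F F {x} {y} e with mem F x y | ∧-true⁻ {adj G x y} e
  ... | false | _ = refl

  delAdj-irrefl : (F : EdgeSet G) (x : Fin n) → delAdj F x x ≡ false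
  delAdj-irrefl F x rewrite irrefl G x = refl

  mem-irrefl : (F : EdgeSet G) (x : Fin n) → mem F x x ≡ false
  mem-irrefl F x with mem F x x in m
  ... | false = refl
  ... | true  = ⊥-elim (not-¬ (memSub F x x m) (irrefl G x))

  module Rewiring (F : EdgeSet G) (D A : Fin n → Fin n → Bool) (D-sym : ∀ x y → D x y ≡ D y x)
    (A-sym : ∀ x y → A x y ≡ A y x) (A⊆G : ∀ x y → A x y ≡ true → adj G x y ≡ true) where

    rewired : EdgeSet G
    rewired = record
      { mem    = λ x y → (mem F x y ∧ not (D x y)) ∨ A x y
      ; memSym = λ x y → cong₂ _∨_ (cong₂ (λ m d → m ∧ not d) (memSym F x y) (D-sym x y)) (A-sym x y)
      ; memSub = sub
      }
      where
      sub : ∀ x y → (mem F x y ∧ not (D x y)) ∨ A x y ≡ true → adj G x y ≡ true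
      sub x y e with A x y in a | mem F x y in m
      ... | true  | _    = A⊆G x y a
      ... | false | true = memSub F x y m

    delAdj-rewired : {x y : Fin n} → delAdj rewired x y ≡ true →
      D x y ≡ true ⊎ (A x y ≡ false × delAdj F x y ≡ true)
    delAdj-rewired {x} {y} e with D x y | A x y | mem F x y | adj G x y
    ... | true  | _     | _     | _    = inj₁ refl
    ... | false | false | false | true = inj₂ (refl , refl)

    degreeSum-rewired : (∀ x y → D x y ≡ true → mem F x y ≡ true) →
      (∀ x y → A x y ≡ true → mem F x y ≡ false) →
      degreeSum (mem rewired) + degreeSum D ≡ degreeSum (mem F) + degreeSum A
    degreeSum-rewired D⊆F A∩F=∅ =
      sum-+-cong (λ u → sum-+-cong (λ v → ind-rewired (mem F u v) (D u v) (A u v) (D⊆F u v) (A∩F=∅ u v)))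
      where
      ind-rewired : ∀ m d a → (d ≡ true → m ≡ true) → (a ≡ true → m ≡ false) →
        ind ((m ∧ not d) ∨ a) + ind d ≡ ind m + ind a
      ind-rewired true  true  true  _   a⇒¬m = contradiction (a⇒¬m refl) λ ()
      ind-rewired true  true  false _   _    = refl
      ind-rewired true  false true  _   a⇒¬m = contradiction (a⇒¬m refl) λ ()
      ind-rewired true  false false _   _    = refl
      ind-rewired false true  _     d⇒m _    = contradiction (d⇒m refl) λ ()
      ind-rewired false false a     _   _    = +-identityʳ (ind a)

module OptimalSolution {n : ℕ} {G : Graph n} {h : ℕ} {F : EdgeSet G} (optimal : Optimal h F) where

  _~_ : Fin n → Fin n → Set
  _~_ = Reach (delAdj F) AllV

  ~-sym : {u v : Fin n} → u ~ v → v ~ u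
  ~-sym = reach-sym (delAdj-sym F)

  not-cheaper : (F′ : EdgeSet G) → ValidSol h F′ → degreeSum (mem F′) < degreeSum (mem F) → ⊥
  not-cheaper F′ valid′ cheaper = <⇒≱ cheaper (begin
    degreeSum (mem F)                                       ≡⟨ handshake-F F ⟨
    pairCount (mem F) + pairCount (mem F)                   ≤⟨ +-mono-≤ F≤F′ F≤F′ ⟩
    pairCount (mem F′) + pairCount (mem F′)                 ≡⟨ handshake-F F′ ⟩
    degreeSum (mem F′)                                      ∎)
    where
    open ≤-Reasoning
    handshake-F : (F″ : EdgeSet G) → pairCount (mem F″) + pairCount (mem F″) ≡ degreeSum (mem F″)
    handshake-F F″ = handshake (memSym F″) (mem-irrefl F″)
    F≤F′ : pairCount (mem F) ≤ pairCount (mem F′)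
    F≤F′ = subst₂ _≤_ (edgeCount≡pairCount F) (edgeCount≡pairCount F′) (proj₂ optimal F′ valid′)

  valid-if-connected : (F′ : EdgeSet G) → (∀ x y → delAdj F′ x y ≡ true → x ~ y) → ValidSol h F′
  valid-if-connected F′ F′⊆~ v xs xs! reach = proj₁ optimal v xs xs! (All.map (reach-map F′⊆~) reach)

  connected-count≤h : {u : Fin n} (p : Fin n → Bool) → (∀ v → p v ≡ true → u ~ v) → count p ≤ h
  connected-count≤h {u} p p⊆~u with count⇒HasSize (λ v → p v ≡ true) p (λ _ → id) (λ _ → id) refl
  ... | ys , ys! , |ys| , ys↔p =
    subst (_≤ h) |ys| (proj₁ optimal u ys ys! (All.tabulate λ {v} → p⊆~u v ∘ proj₁ (ys↔p v)))

  -- Otherwise F without the edge uv is a cheaper solution with the same components.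
  mem-within-component : {u v : Fin n} → u ~ v → mem F u v ≡ false
  mem-within-component {u} {v} u~v with mem F u v in uv∈F
  ... | false = refl
  ... | true  = ⊥-elim (not-cheaper rewired (valid-if-connected rewired rewired⊆~)
                                     (m+o≡n+p⇒p<o⇒m<n cost (s≤s z≤n)))
    where
    D : Fin n → Fin n → Bool
    D = star u (_== v)
    open Rewiring F D (λ _ _ → false) (star-sym u (_== v)) (λ _ _ → refl) (λ _ _ ())
    u≢v : u ≢ v
    u≢v refl = not-¬ uv∈F (mem-irrefl F u)
    D⊆F : ∀ x y → D x y ≡ true → mem F x y ≡ true
    D⊆F x y e with star⁻ u (_== v) {x} {y} e
    ... | inj₁ (refl , y=v) rewrite dec-sound (y ≟ v) y=v = uv∈F
    ... | inj₂ (refl , x=v) rewrite dec-sound (x ≟ v) x=v = trans (memSym F v u) uv∈F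
    |D| : degreeSum D ≡ 2
    |D| = trans (degreeSum-star u (_== v) (dec-false (u ≟ v) u≢v))
                (cong₂ _+_ (count-singleton v) (count-singleton v))
    cost : degreeSum (mem rewired) + 2 ≡ degreeSum (mem F) + 0
    cost = begin
      degreeSum (mem rewired) + 2                        ≡⟨ cong (degreeSum (mem rewired) +_) |D| ⟨
      degreeSum (mem rewired) + degreeSum D              ≡⟨ degreeSum-rewired D⊆F (λ _ _ ()) ⟩
      degreeSum (mem F) + degreeSum {n} (λ _ _ → false)  ≡⟨ cong (degreeSum (mem F) +_) (degreeSum-∅ n) ⟩
      degreeSum (mem F) + 0                              ∎
      where open ≡-Reasoning
    rewired⊆~ : ∀ x y → delAdj rewired x y ≡ true → x ~ y
    rewired⊆~ x y e with delAdj-rewired e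
    ... | inj₂ (_ , xy) = edge xy
    ... | inj₁ d with star⁻ u (_== v) {x} {y} d
    ...   | inj₁ (refl , y=v) rewrite dec-sound (y ≟ v) y=v = u~v
    ...   | inj₂ (refl , x=v) rewrite dec-sound (x ≟ v) x=v = ~-sym u~v

  N[_] : Fin n → Fin n → Bool
  N[ u ] v = (v == u) ∨ delAdj F u v

  N⇒~ : {u v : Fin n} → N[ u ] v ≡ true → u ~ v
  N⇒~ {u} {v} e with v ≟ u
  ... | yes refl = here tt
  ... | no _     = edge e

  N-≢ : {u v : Fin n} → u ≢ v → N[ u ] v ≡ delAdj F u v
  N-≢ {u} {v} u≢v with v ≟ u
  ... | yes refl = ⊥-elim (u≢v refl)
  ... | no _     = refl

  count-N : (u : Fin n) → count N[ u ] ≡ suc (count (delAdj F u))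
  count-N u = trans (count-∨ disjoint) (cong (_+ count (delAdj F u)) (count-singleton u))
    where
    disjoint : ∀ v → v == u ≡ true → delAdj F u v ≡ false
    disjoint v v=u rewrite dec-sound (v ≟ u) v=u = delAdj-irrefl F u

  count-N≤h : (u : Fin n) → count N[ u ] ≤ h
  count-N≤h u = connected-count≤h N[ u ] (λ _ → N⇒~)

  module ComponentsOfC′ (X : Fin n → Bool) (cliques : CliquesAfterRemoving G X) (c : Fin n) where

    C′ : Fin n → Set
    C′ = CPrime X F c

    C′-closed : {u v : Fin n} → C′ u → u ~ v → C′ v
    C′-closed u∈C′ u~v = reach-closed C′-step u~v u∈C′
      where
      C′-step : ∀ x y → delAdj F x y ≡ true → C′ x → C′ y
      C′-step x y e (x∈C , x-avoids-X) =
        reach-snoc x∈C (delAdj⇒adj F e) (x-avoids-X y (edge e)) , λ z y~z → x-avoids-X z (step tt e y~z)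

    C′-adjacent : {u v : Fin n} → C′ u → C′ v → u ≢ v → adj G u v ≡ true
    C′-adjacent {u} {v} (u∈C , _) (v∈C , _) = cliques u v (reach-trans (reach-sym (Graph.sym G) u∈C) v∈C)

    N-component : {u v : Fin n} → C′ u → u ~ v → N[ u ] v ≡ true
    N-component {u} {v} u∈C′ u~v with v ≟ u
    ... | yes _   = refl
    ... | no v≢u rewrite C′-adjacent u∈C′ (C′-closed u∈C′ u~v) (v≢u ∘ sym) | mem-within-component u~v = refl

    N-sym : {u v : Fin n} → C′ u → N[ u ] v ≡ true → N[ v ] u ≡ true
    N-sym u∈C′ uv = N-component (C′-closed u∈C′ (N⇒~ uv)) (~-sym (N⇒~ uv))

    N-trans : {u v w : Fin n} → C′ u → N[ u ] v ≡ true → N[ v ] w ≡ true → N[ u ] w ≡ true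
    N-trans u∈C′ uv vw = N-component u∈C′ (reach-trans (N⇒~ uv) (N⇒~ vw))

    N-closed : {u v : Fin n} → C′ u → N[ u ] v ≡ true → C′ v
    N-closed u∈C′ uv = C′-closed u∈C′ (N⇒~ uv)

    -- b moves into the component K of a: the edges between b and K leave F, the edges of b
    -- in G ∖ F enter it, and the new component of b is K ∪ {b}.
    module Exchange {a b : Fin n} (a∈C′ : C′ a) (b∈C′ : C′ b) (b∉Na : N[ a ] b ≡ false) where

      K δ K⁺ : Fin n → Bool
      K  = N[ a ]
      δ  = delAdj F b
      K⁺ v = (v == b) ∨ K v

      K-closed : {x y : Fin n} → delAdj F x y ≡ true → K x ≡ true → K y ≡ true
      K-closed xy Kx = N-component a∈C′ (reach-snoc (N⇒~ Kx) xy tt)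

      b-K-edges∈F : ∀ z → K z ≡ true → mem F b z ≡ true
      b-K-edges∈F z Kz with mem F b z in bz∈F
      ... | true  = refl
      ... | false = ⊥-elim (not-¬ (K-closed (trans (delAdj-sym F z b) bz) Kz) b∉Na)
        where
        b≢z : b ≢ z
        b≢z refl = not-¬ Kz b∉Na
        bz : delAdj F b z ≡ true
        bz rewrite C′-adjacent b∈C′ (C′-closed a∈C′ (N⇒~ Kz)) b≢z | bz∈F = refl

      K-star⊆F : ∀ x y → star b K x y ≡ true → mem F x y ≡ true
      K-star⊆F x y e with star⁻ b K {x} {y} e
      ... | inj₁ (refl , Ky) = b-K-edges∈F y Ky
      ... | inj₂ (refl , Kx) = trans (memSym F x b) (b-K-edges∈F x Kx)

      δ-star∩F=∅ : ∀ x y → star b δ x y ≡ true → mem F x y ≡ false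
      δ-star∩F=∅ x y e with star⁻ b δ {x} {y} e
      ... | inj₁ (refl , by) = delAdj⇒∉F F by
      ... | inj₂ (refl , bx) = trans (memSym F x b) (delAdj⇒∉F F bx)

      δ-star⊆G : ∀ x y → star b δ x y ≡ true → adj G x y ≡ true
      δ-star⊆G x y e with star⁻ b δ {x} {y} e
      ... | inj₁ (refl , by) = delAdj⇒adj F by
      ... | inj₂ (refl , bx) = trans (Graph.sym G x b) (delAdj⇒adj F bx)

      open Rewiring F (star b K) (star b δ) (star-sym b K) (star-sym b δ) δ-star⊆G public

      cost : degreeSum (mem rewired) + (count K + count K) ≡ degreeSum (mem F) + (count δ + count δ)
      cost = begin
        degreeSum (mem rewired) + (count K + count K)
          ≡⟨ cong (degreeSum (mem rewired) +_) (degreeSum-star b K b∉Na) ⟨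
        degreeSum (mem rewired) + degreeSum (star b K)
          ≡⟨ degreeSum-rewired K-star⊆F δ-star∩F=∅ ⟩
        degreeSum (mem F) + degreeSum (star b δ)
          ≡⟨ cong (degreeSum (mem F) +_) (degreeSum-star b δ (delAdj-irrefl F b)) ⟩
        degreeSum (mem F) + (count δ + count δ)
          ∎
        where open ≡-Reasoning

      rewired-cheaper : count N[ b ] ≤ count K → degreeSum (mem rewired) < degreeSum (mem F)
      rewired-cheaper Nb≤K = m+o≡n+p⇒p<o⇒m<n cost (+-mono-< δ<K δ<K)
        where
        δ<K : count δ < count K
        δ<K = subst (_≤ count K) (count-N b) Nb≤K

      K⁺-centre : K⁺ b ≡ true
      K⁺-centre rewrite dec-true (b ≟ b) refl = refl

      K⊆K⁺ : {v : Fin n} → K v ≡ true → K⁺ v ≡ true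
      K⊆K⁺ {v} Kv rewrite Kv = ∨-zeroʳ (v == b)

      count-K⁺ : count K⁺ ≡ suc (count K)
      count-K⁺ = trans (count-∨ disjoint) (cong (_+ count K) (count-singleton b))
        where
        disjoint : ∀ v → v == b ≡ true → K v ≡ false
        disjoint v v=b rewrite dec-sound (v ≟ b) v=b = b∉Na

      rewired-edge : ∀ x y → delAdj rewired x y ≡ true →
        K⁺ x ≡ K⁺ y × (K⁺ x ≡ false → delAdj F x y ≡ true)
      rewired-edge x y e with delAdj-rewired e
      ... | inj₁ d with star⁻ b K {x} {y} d
      ...   | inj₁ (refl , Ky) = trans K⁺-centre (sym (K⊆K⁺ Ky)) , λ K⁺b → ⊥-elim (not-¬ K⁺-centre K⁺b)
      ...   | inj₂ (refl , Kx) = trans (K⊆K⁺ Kx) (sym K⁺-centre) , λ K⁺x → ⊥-elim (not-¬ (K⊆K⁺ Kx) K⁺x)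
      rewired-edge x y e | inj₂ (xy∉A , xy) = K⁺x≡K⁺y , λ _ → xy
        where
        x≢b : x ≢ b
        x≢b refl = not-¬ (star-centre b δ xy) xy∉A
        y≢b : y ≢ b
        y≢b refl = not-¬ (trans (star-sym b δ x b) (star-centre b δ (trans (delAdj-sym F b x) xy))) xy∉A
        K⁺x≡K⁺y : K⁺ x ≡ K⁺ y
        K⁺x≡K⁺y rewrite dec-false (x ≟ b) x≢b | dec-false (y ≟ b) y≢b =
          ⇔→≡ (mk⇔ (K-closed xy) (K-closed (trans (delAdj-sym F y x) xy)))

      rewired-valid : count K < h → ValidSol h rewired
      rewired-valid K<h v xs xs! reach with K⁺ v in K⁺v
      ... | true  = begin
        length xs    ≤⟨ unique-length≤count K⁺ xs! (All.map (λ r → reach-closed inside r K⁺v) reach) ⟩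
        count K⁺     ≡⟨ count-K⁺ ⟩
        suc (count K) ≤⟨ K<h ⟩
        h            ∎
        where
        open ≤-Reasoning
        inside : ∀ x y → delAdj rewired x y ≡ true → K⁺ x ≡ true → K⁺ y ≡ true
        inside x y e K⁺x = trans (sym (proj₁ (rewired-edge x y e))) K⁺x
      ... | false = proj₁ optimal v xs xs! (All.map (λ r → reach-restrict outside r K⁺v) reach)
        where
        outside : ∀ x y → delAdj rewired x y ≡ true → K⁺ x ≡ false → K⁺ y ≡ false × delAdj F x y ≡ true
        outside x y e K⁺x = trans (sym (proj₁ (rewired-edge x y e))) K⁺x , proj₂ (rewired-edge x y e) K⁺x

    exchange : {a b : Fin n} → C′ a → C′ b → N[ a ] b ≡ false →
      count N[ a ] < h → count N[ b ] ≤ count N[ a ] → ⊥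
    exchange a∈C′ b∈C′ b∉Na Na<h Nb≤Na = not-cheaper rewired (rewired-valid Na<h) (rewired-cheaper Nb≤Na)
      where open Exchange a∈C′ b∈C′ b∉Na

    at-most-one-small : {u v : Fin n} → C′ u → C′ v → N[ u ] v ≡ false →
      h ≤ count N[ u ] ⊎ h ≤ count N[ v ]
    at-most-one-small {u} {v} u∈C′ v∈C′ v∉Nu with h ≤? count N[ u ] | h ≤? count N[ v ]
    ... | yes h≤Nu | _        = inj₁ h≤Nu
    ... | no _     | yes h≤Nv = inj₂ h≤Nv
    ... | no Nu≱h  | no Nv≱h with ≤-total (count N[ v ]) (count N[ u ])
    ...   | inj₁ Nv≤Nu = ⊥-elim (exchange u∈C′ v∈C′ v∉Nu (≰⇒> Nu≱h) Nv≤Nu)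
    ...   | inj₂ Nu≤Nv = ⊥-elim (exchange v∈C′ u∈C′ u∉Nv (≰⇒> Nv≱h) Nu≤Nv)
      where
      u∉Nv : N[ v ] u ≡ false
      u∉Nv = ¬-not λ u∈Nv → not-¬ (N-sym v∈C′ u∈Nv) v∉Nu

module Partition {n : ℕ} (h : ℕ) (E : Fin n → Fin n → Bool) (S₀ : Fin n → Set)
  (E-sym     : ∀ {u v} → S₀ u → E u v ≡ true → E v u ≡ true)
  (E-trans   : ∀ {u v w} → S₀ u → E u v ≡ true → E v w ≡ true → E u w ≡ true)
  (E-closed  : ∀ {u v} → S₀ u → E u v ≡ true → S₀ v)
  (class≤h   : ∀ u → count (E u) ≤ h)
  (one-small : ∀ {u v} → S₀ u → S₀ v → E u v ≡ false → h ≤ count (E u) ⊎ h ≤ count (E v))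
  where

  Inside : (Fin n → Bool) → Set
  Inside S = ∀ u → S u ≡ true → S₀ u

  Closed : (Fin n → Bool) → Set
  Closed S = ∀ u v → S u ≡ true → E u v ≡ true → S v ≡ true

  record Labelling (q r : ℕ) (S : Fin n → Bool) : Set where
    field
      label   : Fin n → Fin (suc q)
      classes : ∀ u v → S u ≡ true → S v ≡ true →
                (E u v ≡ true → label u ≡ label v) × (label u ≡ label v → E u v ≡ true)
      full    : ∀ (i : Fin q) → count (λ v → S v ∧ (label v == inject₁ i)) ≡ h
      rest    : count (λ v → S v ∧ (label v == fromℕ q)) ≡ r

  module _ {S : Fin n → Bool} (S⊆S₀ : Inside S) (S-closed : Closed S) where

    class≤S : ∀ {u} → S u ≡ true → count (E u) ≤ count S
    class≤S {u} su = count-mono (λ v → S-closed u v su)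

    one-class : count S < h → ∀ u v → S u ≡ true → S v ≡ true → E u v ≡ true
    one-class S<h u v su sv with E u v in uv
    ... | true  = refl
    ... | false with one-small (S⊆S₀ u su) (S⊆S₀ v sv) uv
    ...   | inj₁ h≤Eu = ⊥-elim (<⇒≱ S<h (≤-trans h≤Eu (class≤S su)))
    ...   | inj₂ h≤Ev = ⊥-elim (<⇒≱ S<h (≤-trans h≤Ev (class≤S sv)))

    full-class : 0 < h → h ≤ count S → ∃ λ a → S a ≡ true × count (E a) ≡ h
    full-class h>0 h≤S
      with count-witness {p = λ _ → false} (subst (_< count S) (sym (count-false n)) (<-≤-trans h>0 h≤S))
    ... | a , sa , _ with h ≤? count (E a)
    ...   | yes h≤Ea = a , sa , ≤-antisym (class≤h a) h≤Ea
    ...   | no h≰Ea with count-witness {p = E a} (<-≤-trans (≰⇒> h≰Ea) h≤S)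
    ...     | b , sb , b∉Ea with one-small (S⊆S₀ a sa) (S⊆S₀ b sb) b∉Ea
    ...       | inj₁ h≤Ea = ⊥-elim (h≰Ea h≤Ea)
    ...       | inj₂ h≤Eb = b , sb , ≤-antisym (class≤h b) h≤Eb

    module Peel {a : Fin n} (sa : S a ≡ true) where

      S′ : Fin n → Bool
      S′ v = S v ∧ not (E a v)

      S′-intro : ∀ {v} → S v ≡ true → E a v ≡ false → S′ v ≡ true
      S′-intro sv av rewrite sv | av = refl

      S′-inside : Inside S′
      S′-inside u s′u = S⊆S₀ u (proj₁ (∧-true⁻ s′u))

      S′-closed : Closed S′
      S′-closed u v s′u uv with S u in su | E a u in au | E a v in av
      ... | true | false | false = cong (_∧ true) (S-closed u v su uv)
      ... | true | false | true  = ⊥-elim (not-¬ (E-trans (S⊆S₀ a sa) av (E-sym (S⊆S₀ u su) uv)) au)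

      count-S′ : count S ≡ count (E a) + count S′
      count-S′ = count-∖ (λ v → S-closed a v sa)

      peel : ∀ {q r} → count (E a) ≡ h → Labelling q r S′ → Labelling (suc q) r S
      peel {q} {r} |Ea| L = record { label = label ; classes = classes ; full = full ; rest = rest }
        where
        module L = Labelling L

        label : Fin n → Fin (suc (suc q))
        label v = if E a v then zero else suc (L.label v)

        classes : ∀ u v → S u ≡ true → S v ≡ true →
                  (E u v ≡ true → label u ≡ label v) × (label u ≡ label v → E u v ≡ true)
        classes u v su sv with E a u in au | E a v in av
        ... | true  | true  = (λ _ → refl) , λ _ → E-trans (S⊆S₀ u su) (E-sym (S⊆S₀ a sa) au) av
        ... | true  | false = (λ uv → ⊥-elim (not-¬ (E-trans (S⊆S₀ a sa) au uv) av)) , λ ()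
        ... | false | true  = (λ uv → ⊥-elim (not-¬ (E-trans (S⊆S₀ a sa) av (E-sym (S⊆S₀ u su) uv)) au)) , λ ()
        ... | false | false = (λ uv → cong suc (proj₁ classes′ uv)) , λ eq → proj₂ classes′ (suc-injective eq)
          where
          classes′ : (E u v ≡ true → L.label u ≡ L.label v) × (L.label u ≡ L.label v → E u v ≡ true)
          classes′ = L.classes u v (S′-intro su au) (S′-intro sv av)

        shift : ∀ t v → (S v ∧ (label v == suc t)) ≡ (S′ v ∧ (L.label v == t))
        shift t v with E a v
        ... | true  = trans (∧-zeroʳ (S v)) (sym (cong (_∧ (L.label v == t)) (∧-zeroʳ (S v))))
        ... | false = sym (cong (_∧ (L.label v == t)) (∧-identityʳ (S v)))

        first-class : ∀ v → (S v ∧ (label v == zero)) ≡ E a v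
        first-class v with E a v in av
        ... | true  = trans (∧-identityʳ (S v)) (S-closed a v sa av)
        ... | false = ∧-zeroʳ (S v)

        full : ∀ (i : Fin (suc q)) → count (λ v → S v ∧ (label v == inject₁ i)) ≡ h
        full zero    = trans (count-cong first-class) |Ea|
        full (suc i) = trans (count-cong (shift (inject₁ i))) (L.full i)

        rest : count (λ v → S v ∧ (label v == fromℕ (suc q))) ≡ r
        rest = trans (count-cong (shift (fromℕ q))) L.rest

  partition : 0 < h → ∀ q r → r < h → {S : Fin n → Bool} → Inside S → Closed S →
    count S ≡ q * h + r → Labelling q r S
  partition h>0 zero r r<h {S} S⊆S₀ S-closed |S| = record
    { label   = λ _ → zero
    ; classes = λ u v su sv → (λ _ → refl) , λ _ → one-class S⊆S₀ S-closed (subst (_< h) (sym |S|) r<h) u v su sv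
    ; full    = λ ()
    ; rest    = trans (count-cong (λ v → ∧-identityʳ (S v))) |S|
    }
  partition h>0 (suc q) r r<h {S} S⊆S₀ S-closed |S|
    with full-class S⊆S₀ S-closed h>0 (subst (h ≤_) (sym |S|) (≤-trans (m≤m+n h (q * h)) (m≤m+n _ r)))
  ... | a , sa , |Ea| = peel |Ea| (partition h>0 q r r<h S′-inside S′-closed |S′|)
    where
    open Peel S⊆S₀ S-closed sa
    |S′| : count S′ ≡ q * h + r
    |S′| = +-cancelˡ-≡ h _ _ (begin
      h + count S′              ≡⟨ cong (_+ count S′) |Ea| ⟨
      count (E a) + count S′    ≡⟨ count-S′ ⟨
      count S                   ≡⟨ |S| ⟩
      h + q * h + r             ≡⟨ +-assoc h (q * h) r ⟩
      h + (q * h + r)           ∎)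
      where open ≡-Reasoning

lemma1 : ∀ {n : ℕ} (G : Graph n) (h : ℕ) → 0 < h →
    (X : Fin n → Bool) → CliquesAfterRemoving G X →
    (F : EdgeSet G) → Optimal h F →
    (c : Fin n) → X c ≡ false →
    (q r : ℕ) → r < h → HasSize (CPrime X F c) (q * h + r) →
    Σ (Fin n → Fin (suc q)) λ lab →
      (∀ u v → CPrime X F c u → CPrime X F c v → (u ≡ v → ⊥) →
         (delAdj F u v ≡ true → lab u ≡ lab v) × (lab u ≡ lab v → delAdj F u v ≡ true))
      × (∀ (i : Fin q) → HasSize (λ v → CPrime X F c v × lab v ≡ inject₁ i) h)
      × HasSize (λ v → CPrime X F c v × lab v ≡ fromℕ q) r
lemma1 G h h>0 X cliques F optimal c _ q r r<h C′-size@(xs , _ , _ , xs↔C′) =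
  label , edges , (λ i → fibre (inject₁ i) (full i)) , fibre (fromℕ q) rest
  where
  open OptimalSolution {G = G} {h} {F} optimal
  open ComponentsOfC′ X cliques c
  open Partition h N[_] C′ N-sym N-trans N-closed count-N≤h at-most-one-small

  -- The enumeration xs of C′ makes membership in C′ decidable.
  S : Fin _ → Bool
  S = _∈ᵇ xs

  S⇒C′ : ∀ v → S v ≡ true → C′ v
  S⇒C′ v = proj₁ (xs↔C′ v) ∘ ∈ᵇ⇒∈ xs

  C′⇒S : ∀ v → C′ v → S v ≡ true
  C′⇒S v = ∈⇒∈ᵇ ∘ proj₂ (xs↔C′ v)

  open Labelling (partition h>0 q r r<h S⇒C′ (λ u v su uv → C′⇒S v (N-closed (S⇒C′ u su) uv))
                            (HasSize⇒count C′-size))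

  edges : ∀ u v → C′ u → C′ v → u ≢ v →
    (delAdj F u v ≡ true → label u ≡ label v) × (label u ≡ label v → delAdj F u v ≡ true)
  edges u v u∈C′ v∈C′ u≢v = subst (λ b → (b ≡ true → label u ≡ label v) × (label u ≡ label v → b ≡ true))
    (N-≢ u≢v) (classes u v (C′⇒S u u∈C′) (C′⇒S v v∈C′))

  fibre : (t : Fin (suc q)) {k : ℕ} → count (λ v → S v ∧ (label v == t)) ≡ k →
    HasSize (λ v → C′ v × label v ≡ t) k
  fibre = fibre-size C′ S C′⇒S S⇒C′ label
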